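{- For every integer $n\ge0$, the McKinsey axiom $\Box\Diamond p\to\Diamond\Box p$ is valid in the frame $\mathfrak F_n$ if and only if $n$ is even.
   Context: $\mathfrak F_n=(W,R)$ has domain $W=\{r\}\cup\{a_i:0\le i\le n\}\cup\{b_i:0\le i\le n\}$ (all distinct), and $R$ consists exactly of: $(r,a_i)$ for all $0\le i\le n$; $(a_i,b_j)$ iff $j=i$ or $j=i+1$, where $i+1$ is read as $0$ when $i=n$; and $(b_i,b_i)$ for all $0\le i\le n$. A modal formula is valid in a frame if it is true at every point under every valuation. -}

module Defs where

open import Data.Nat using (ℕ; zero; suc)
open import Data.Nat.DivMod using (_%_)
open import Data.Nat.Divisibility using (_∣_)
open import Data.Fin using (Fin; toℕ)
open import Data.Bool using (Bool; true)
open import Data.Product using (Σ; _×_)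
open import Data.Sum using (_⊎_)
open import Data.Empty using (⊥)
open import Relation.Binary.PropositionalEquality using (_≡_)

data Form : Set where
  var  : ℕ → Form
  ⊥'   : Form
  _⇒_  : Form → Form → Form
  □_   : Form → Form

infixr 5 _⇒_
infix 7 □_

¬' : Form → Form
¬' φ = φ ⇒ ⊥'

◇_ : Form → Form
◇ φ = ¬' (□ (¬' φ))
infix 7 ◇_

record Frame : Set₁ where
  field
    W : Set
    R : W → W → Set
open Frame public

Valuation : Frame → Set
Valuation F = ℕ → W F → Bool

_,_⊨_at_ : (F : Frame) → Valuation F → Form → W F → Set
F , V ⊨ var k at w = V k w ≡ true
F , V ⊨ ⊥' at w = ⊥
F , V ⊨ (φ ⇒ ψ) at w = F , V ⊨ φ at w → F , V ⊨ ψ at w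
F , V ⊨ □ φ at w = ∀ v → R F w v → F , V ⊨ φ at v

Valid : Frame → Form → Set
Valid F φ = ∀ (V : Valuation F) (w : W F) → F , V ⊨ φ at w

McKinsey : Form
McKinsey = □ ◇ var 0 ⇒ ◇ □ var 0

data Pt (n : ℕ) : Set where
  r : Pt n
  a : Fin (suc n) → Pt n
  b : Fin (suc n) → Pt n

data Rel (n : ℕ) : Pt n → Pt n → Set where
  r-a   : (i : Fin (suc n)) → Rel n r (a i)
  a-b   : (i j : Fin (suc n)) →
          (toℕ j ≡ toℕ i) ⊎ (toℕ j ≡ suc (toℕ i) % suc n) →
          Rel n (a i) (b j)
  b-b   : (i : Fin (suc n)) → Rel n (b i) (b i)

𝔉 : ℕ → Frame
𝔉 n = record { W = Pt n ; R = Rel n }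

Even : ℕ → Set
Even n = 2 ∣ n

-- Every aᵢ and bᵢ sees some bⱼ, whose only successor is bⱼ itself; there ◇p gives □p, so
-- McKinsey holds. At r it fails exactly when every aᵢ sees both a p-point and a ¬p-point,
-- i.e. when p alternates along the cycle b₀ → b₁ → ⋯ → bₙ → b₀, and a cycle of length
-- n + 1 admits such an alternating colouring exactly when n + 1 is even.
module Submission where

open import Defs
open import Data.Bool using (Bool; true; false; not; _xor_)
open import Data.Bool.Properties using (not-involutive; not-¬; not-distribˡ-xor; xor-identityʳ)
open import Data.Empty using (⊥-elim)
open import Data.Fin using (Fin; zero; toℕ; fromℕ<)
open import Data.Fin.Properties using (toℕ-fromℕ<; toℕ-injective)
open import Data.Nat using (ℕ; zero; suc; _+_; _*_; NonZero)
open import Data.Nat.DivMod using (_%_; _/_; m%n<n; m%n%n≡m%n; n%n≡0; %-distribˡ-+; m≡m%n+[m/n]*n)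
open import Data.Nat.Divisibility using (divides; _∣0; ∣-refl; ∣m∣n⇒∣m+n)
open import Data.Product using (_×_; _,_)
open import Data.Sum using (_⊎_; inj₁; inj₂)
open import Function using (_∘_)
open import Relation.Nullary using (¬_; contradiction)
open import Relation.Binary.PropositionalEquality

-- Bool-valued (unlike Data.Nat.parity) so that it is directly a colouring of the bᵢ.
odd : ℕ → Bool
odd zero    = false
odd (suc m) = not (odd m)

odd-+ : ∀ m n → odd (m + n) ≡ odd m xor odd n
odd-+ zero    n = refl
odd-+ (suc m) n = begin
  not (odd (m + n))        ≡⟨ cong not (odd-+ m n) ⟩
  not (odd m xor odd n)    ≡⟨ not-distribˡ-xor (odd m) (odd n) ⟩
  not (odd m) xor odd n    ∎
  where open ≡-Reasoning

odd-*-even : ∀ m {d} → odd d ≡ false → odd (m * d) ≡ false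
odd-*-even zero    _      = refl
odd-*-even (suc m) {d} ed = begin
  odd (d + m * d)            ≡⟨ odd-+ d (m * d) ⟩
  odd d xor odd (m * d)      ≡⟨ cong₂ _xor_ ed (odd-*-even m ed) ⟩
  false                      ∎
  where open ≡-Reasoning

odd-% : ∀ m d .{{_ : NonZero d}} → odd d ≡ false → odd (m % d) ≡ odd m
odd-% m d ed = sym (begin
  odd m                                ≡⟨ cong odd (m≡m%n+[m/n]*n m d) ⟩
  odd (m % d + (m / d) * d)            ≡⟨ odd-+ (m % d) ((m / d) * d) ⟩
  odd (m % d) xor odd ((m / d) * d)    ≡⟨ cong (odd (m % d) xor_) (odd-*-even (m / d) ed) ⟩
  odd (m % d) xor false                ≡⟨ xor-identityʳ (odd (m % d)) ⟩
  odd (m % d)                          ∎)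
  where open ≡-Reasoning

even⇒odd≡false : ∀ {n} → Even n → odd n ≡ false
even⇒odd≡false (divides q refl) = odd-*-even q refl

odd≡false⇒even : ∀ n → odd n ≡ false → Even n
odd≡false⇒even zero          _ = 2 ∣0
odd≡false⇒even (suc (suc n)) e =
  ∣m∣n⇒∣m+n ∣-refl (odd≡false⇒even n (trans (sym (not-involutive (odd n))) e))

module _ {n : ℕ} where

  next : Fin (suc n) → Fin (suc n)
  next i = fromℕ< (m%n<n (suc (toℕ i)) (suc n))

  toℕ-next : ∀ i → toℕ (next i) ≡ suc (toℕ i) % suc n
  toℕ-next i = toℕ-fromℕ< (m%n<n (suc (toℕ i)) (suc n))

  walk : ℕ → Fin (suc n)
  walk zero    = zero
  walk (suc k) = next (walk k)

  toℕ-walk : ∀ k → toℕ (walk k) ≡ k % suc n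
  toℕ-walk zero    = refl
  toℕ-walk (suc k) = begin
    toℕ (next (walk k))                   ≡⟨ toℕ-next (walk k) ⟩
    suc (toℕ (walk k)) % suc n            ≡⟨ cong (λ m → suc m % suc n) (toℕ-walk k) ⟩
    (1 + k % suc n) % suc n               ≡⟨ %-distribˡ-+ 1 (k % suc n) (suc n) ⟩
    (1 % suc n + k % suc n % suc n) % suc n
      ≡⟨ cong (λ m → (1 % suc n + m) % suc n) (m%n%n≡m%n k (suc n)) ⟩
    (1 % suc n + k % suc n) % suc n       ≡⟨ %-distribˡ-+ 1 k (suc n) ⟨
    suc k % suc n                         ∎
    where open ≡-Reasoning

  walk-around : walk (suc n) ≡ zero
  walk-around = toℕ-injective (trans (toℕ-walk (suc n)) (n%n≡0 (suc n)))

  Alternating : (Fin (suc n) → Bool) → Set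
  Alternating c = ∀ i → c (next i) ≡ not (c i)

  alternating-walk : ∀ {c} → Alternating c → ∀ k → c (walk k) ≡ odd k xor c zero
  alternating-walk     alt zero    = refl
  alternating-walk {c} alt (suc k) = begin
    c (next (walk k))            ≡⟨ alt (walk k) ⟩
    not (c (walk k))             ≡⟨ cong not (alternating-walk alt k) ⟩
    not (odd k xor c zero)       ≡⟨ not-distribˡ-xor (odd k) (c zero) ⟩
    not (odd k) xor c zero       ∎
    where open ≡-Reasoning

  alternating⇒odd : ∀ {c} → Alternating c → odd n ≡ true
  alternating⇒odd {c} alt =
    closes (odd n) (trans (cong c (sym walk-around)) (alternating-walk alt (suc n)))
    where
    closes : ∀ p → c zero ≡ not p xor c zero → p ≡ true
    closes true  _ = refl
    closes false e = contradiction e (not-¬ refl)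

  odd⇒alternating : odd n ≡ true → Alternating (odd ∘ toℕ)
  odd⇒alternating odd-n i = begin
    odd (toℕ (next i))                ≡⟨ cong odd (toℕ-next i) ⟩
    odd (suc (toℕ i) % suc n)         ≡⟨ odd-% (suc (toℕ i)) (suc n) (cong not odd-n) ⟩
    not (odd (toℕ i))                 ∎
    where open ≡-Reasoning

AtMostOneSuccessor : (F : Frame) → W F → Set
AtMostOneSuccessor F u = ∀ {v v′} → R F u v → R F u v′ → v ≡ v′

module _ {F : Frame} (V : Valuation F) where

  ◇p⇒□p : ∀ {u} → AtMostOneSuccessor F u → F , V ⊨ ◇ var 0 at u → F , V ⊨ □ var 0 at u
  ◇p⇒□p unique ◇p v uRv with V 0 v in pv
  ... | true  = refl
  ... | false = ⊥-elim (◇p λ v′ uRv′ pv′ →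
                  not-¬ pv (subst (λ x → V 0 x ≡ true) (unique uRv′ uRv) pv′))

  sees-at-most-one-successor⇒McKinsey : ∀ {w u} → R F w u → AtMostOneSuccessor F u →
                                        F , V ⊨ McKinsey at w
  sees-at-most-one-successor⇒McKinsey {u = u} wRu unique □◇p □¬□p =
    □¬□p u wRu (◇p⇒□p unique (□◇p u wRu))

module _ {n : ℕ} where

  b-at-most-one-successor : ∀ {i} → AtMostOneSuccessor (𝔉 n) (b i)
  b-at-most-one-successor (b-b _) (b-b _) = refl

  a-sees-b : ∀ i → Rel n (a i) (b i)
  a-sees-b i = a-b i i (inj₁ refl)

  a-sees-b-next : ∀ i → Rel n (a i) (b (next i))
  a-sees-b-next i = a-b i (next i) (inj₂ (toℕ-next i))

  a-successors : ∀ {i v} → Rel n (a i) v → v ≡ b i ⊎ v ≡ b (next i)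
  a-successors (a-b i j (inj₁ j≡i))      = inj₁ (cong b (toℕ-injective j≡i))
  a-successors (a-b i j (inj₂ j≡1+i%N)) =
    inj₂ (cong b (toℕ-injective (trans j≡1+i%N (sym (toℕ-next i)))))

  □-at-a : ∀ (P : Pt n → Set) {i} → P (b i) → P (b (next i)) → ∀ v → Rel n (a i) v → P v
  □-at-a P Pbᵢ Pbₙₑₓₜ v aRv with a-successors aRv
  ... | inj₁ refl = Pbᵢ
  ... | inj₂ refl = Pbₙₑₓₜ

  refuted-at-r⇒alternating : ∀ V → 𝔉 n , V ⊨ □ ◇ var 0 at r → 𝔉 n , V ⊨ □ ¬' (□ var 0) at r →
                             Alternating (λ i → V 0 (b i))
  refuted-at-r⇒alternating V □◇p □¬□p i with V 0 (b i) in pᵢ | V 0 (b (next i)) in pₙₑₓₜ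
  ... | true  | false = refl
  ... | false | true  = refl
  ... | true  | true  = ⊥-elim (□¬□p (a i) (r-a i) (□-at-a (λ v → V 0 v ≡ true) pᵢ pₙₑₓₜ))
  ... | false | false =
    ⊥-elim (□◇p (a i) (r-a i) (□-at-a (λ v → V 0 v ≢ true) (not-¬ pᵢ) (not-¬ pₙₑₓₜ)))

  ¬alternating⇒McKinsey-at-r : ∀ V → ¬ Alternating (λ i → V 0 (b i)) → 𝔉 n , V ⊨ McKinsey at r
  ¬alternating⇒McKinsey-at-r V ¬alt □◇p □¬□p = ¬alt (refuted-at-r⇒alternating V □◇p □¬□p)

  colouring : (Fin (suc n) → Bool) → Valuation (𝔉 n)
  colouring c _ (b j) = c j
  colouring c _ _     = false

  alternating⇒¬McKinsey-at-r : ∀ {c} → Alternating c → ¬ (𝔉 n , colouring c ⊨ McKinsey at r)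
  alternating⇒¬McKinsey-at-r {c} alt McKinsey-at-r = McKinsey-at-r □◇p □¬□p
    where
    □◇p : 𝔉 n , colouring c ⊨ □ ◇ var 0 at r
    □◇p .(a i) (r-a i) □¬p with c i in cᵢ
    ... | true  = □¬p (b i) (a-sees-b i) cᵢ
    ... | false = □¬p (b (next i)) (a-sees-b-next i) (trans (alt i) (cong not cᵢ))
    □¬□p : 𝔉 n , colouring c ⊨ □ ¬' (□ var 0) at r
    □¬□p .(a i) (r-a i) □p =
      not-¬ (cong not (□p (b i) (a-sees-b i)))
            (trans (sym (alt i)) (□p (b (next i)) (a-sees-b-next i)))

lemma5p7 : (n : ℕ) → (Valid (𝔉 n) McKinsey → Even n) × (Even n → Valid (𝔉 n) McKinsey)
lemma5p7 n = valid⇒even , even⇒valid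
  where
  valid⇒even : Valid (𝔉 n) McKinsey → Even n
  valid⇒even valid with odd n in odd-n
  ... | false = odd≡false⇒even n odd-n
  ... | true  = contradiction (valid (colouring (odd ∘ toℕ)) r)
                              (alternating⇒¬McKinsey-at-r (odd⇒alternating odd-n))

  even⇒valid : Even n → Valid (𝔉 n) McKinsey
  even⇒valid even V r =
    ¬alternating⇒McKinsey-at-r V λ alt → not-¬ (alternating⇒odd alt) (even⇒odd≡false even)
  even⇒valid _ V (a i) = sees-at-most-one-successor⇒McKinsey V (a-sees-b i) b-at-most-one-successor
  even⇒valid _ V (b i) = sees-at-most-one-successor⇒McKinsey V (b-b i) b-at-most-one-successor
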